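{- Let $G$ be a graph with $\Delta(G)\le r$ and let $T$ be a tight clique in $G$ with $|T|\ge 2$. Let $S=S_T=\bigcap_{x\in T}N(x)$ and let $R=R_T$ be the graph on vertex set $S$ whose edges are the pairs of vertices of $S$ not adjacent in $G$. Suppose $R$ has a connected component isomorphic to $K_2$, on vertices $u$ and $v$. Let $G'$ be the graph obtained from $G$ by adding the edge $uv$ and deleting all edges between $\{u,v\}$ and $V(G)\setminus(T\cup S)$. Then $\Delta(G')\le r$ and $k(G')>k(G)$.
   Context: Graphs are finite and simple. A clique is a set of pairwise adjacent vertices (the empty set included), and $k(G)$ is the number of cliques of $G$. For a nonempty clique $C$, $w(C)=|\bigcap_{x\in C}N(x)|$ is the number of common neighbors of its vertices; with $\Delta(G)\le r$, a nonempty clique $C$ is tight if $w(C)=r+1-|C|$. -}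

module Defs where

open import Data.Nat using (ℕ; zero; suc; _+_; _∸_; _≤_)
open import Data.Bool using (Bool; true; false; _∧_; _∨_; not; if_then_else_)
open import Data.Fin using (Fin; _≟_)
open import Data.Fin.Subset using (Subset; ∣_∣)
open import Data.Vec using (Vec; []; _∷_; lookup; tabulate)
open import Data.List using (List; []; _∷_; map; _++_; length; filterᵇ; allFin)
open import Data.Bool.ListAction using (and)
open import Relation.Nullary.Decidable using (⌊_⌋)
open import Relation.Binary.PropositionalEquality using (_≡_)

-- A (finite simple) graph on vertex set Fin n is given by a Bool-valued
-- adjacency function; simplicity (symmetry, irreflexivity) is imposed as
-- hypotheses in the statement.
Adj : ℕ → Set
Adj n = Fin n → Fin n → Bool

Symmetric : ∀ {n} → Adj n → Set
Symmetric {n} E = (x y : Fin n) → E x y ≡ E y x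

Irreflexive : ∀ {n} → Adj n → Set
Irreflexive {n} E = (x : Fin n) → E x x ≡ false

_∈ᵇ_ : ∀ {n} → Fin n → Subset n → Bool
x ∈ᵇ C = lookup C x

N : ∀ {n} → Adj n → Fin n → Subset n
N E x = tabulate (E x)

deg : ∀ {n} → Adj n → Fin n → ℕ
deg E x = ∣ N E x ∣

MaxDeg≤ : ∀ {n} → Adj n → ℕ → Set
MaxDeg≤ {n} E r = (x : Fin n) → deg E x ≤ r

isClique : ∀ {n} → Adj n → Subset n → Bool
isClique {n} E C =
  and (map (λ x → and (map (λ y →
        not (x ∈ᵇ C ∧ y ∈ᵇ C ∧ not ⌊ x ≟ y ⌋) ∨ E x y) (allFin n))) (allFin n))

allSubsets : (n : ℕ) → List (Subset n)
allSubsets zero = [] ∷ []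
allSubsets (suc n) = map (false ∷_) (allSubsets n) ++ map (true ∷_) (allSubsets n)

-- k(G): number of cliques (including the empty one)
k : ∀ {n} → Adj n → ℕ
k {n} E = length (filterᵇ (isClique E) (allSubsets n))

commonNbrᵇ : ∀ {n} → Adj n → Subset n → Fin n → Bool
commonNbrᵇ {n} E C x = and (map (λ y → not (y ∈ᵇ C) ∨ E y x) (allFin n))

commonNbrs : ∀ {n} → Adj n → Subset n → Subset n
commonNbrs E C = tabulate (commonNbrᵇ E C)

w : ∀ {n} → Adj n → Subset n → ℕ
w E C = ∣ commonNbrs E C ∣

Tight : ∀ {n} → Adj n → ℕ → Subset n → Set
Tight E r C = (isClique E C ≡ true) × (1 ≤ ∣ C ∣) × (w E C ≡ r + 1 ∸ ∣ C ∣)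
  where open import Data.Product using (_×_)

-- In R_T (vertex set S_T, edges = non-adjacent pairs of G inside S_T),
-- the component containing u and v is exactly {u,v} and uv is an edge:
-- u ≠ v, u,v ∈ S, u,v non-adjacent in G, and no other vertex z ∈ S is
-- non-adjacent in G to u or to v.
K2ComponentOfR : ∀ {n} → Adj n → Subset n → Fin n → Fin n → Set
K2ComponentOfR {n} E T u v =
  (¬ u ≡ v) × (u ∈ᵇ S ≡ true) × (v ∈ᵇ S ≡ true) × (E u v ≡ false) ×
  ((z : Fin n) → z ∈ᵇ S ≡ true → ¬ z ≡ u → ¬ z ≡ v →
     (E z u ≡ true) × (E z v ≡ true))
  where
    open import Data.Product using (_×_)
    open import Relation.Nullary using (¬_)
    S = commonNbrs E T

modify : ∀ {n} → Adj n → Subset n → Fin n → Fin n → Adj n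
modify E T u v x y =
  if (isUV x ∧ isUV y ∧ not ⌊ x ≟ y ⌋) then true
  else if (isUV x ∧ not (inTS y)) ∨ (isUV y ∧ not (inTS x)) then false
  else E x y
  where
    isUV : _ → Bool
    isUV z = ⌊ z ≟ u ⌋ ∨ ⌊ z ≟ v ⌋
    inTS : _ → Bool
    inTS z = z ∈ᵇ T ∨ z ∈ᵇ commonNbrs E T

-- The vertices of T have r neighbours in T ∪ S (t − 1 in T, r + 1 − t in S),
-- so they have no neighbour outside T ∪ S; u and v see everything in T ∪ S except each
-- other, so each of them has at most one neighbour outside T ∪ S.  Hence the new graph
-- has maximum degree at most r, and a clique of G that is destroyed contains exactly one
-- of u, v together with that vertex's unique outer neighbour, and no vertex of T.
-- Replacing the outer vertex by the other one of u, v and by a vertex of T (x₁ if the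
-- clique contains u, x₂ otherwise) yields a clique of G' that is not a clique of G, and
-- this assignment is injective.  Keeping the surviving cliques fixed gives an injection
-- from the cliques of G into those of G' that misses the new clique {u, v}.
module Submission where

open import Defs
open import Data.Nat using (ℕ; zero; suc; _+_; _∸_; _≤_; _<_; z≤n; s≤s)
open import Data.Nat.Properties
  using (+-comm; +-suc; +-identityʳ; +-mono-≤; ≤-pred; ≤-trans; ≤-reflexive; <-irrefl;
         m≤m+n; m≤n⇒m≤1+n; n≤0⇒n≡0; m+[n∸m]≡n; module ≤-Reasoning)
open import Data.Bool using (Bool; true; false; _∧_; _∨_; not; if_then_else_)
import Data.Bool as Bool
open import Data.Bool.Properties using (T?; T-∨; T-∧; T-≡)
open import Data.Bool.ListAction using (all)
open import Data.Fin using (Fin; zero; suc; _≟_)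
open import Data.Fin.Properties using (suc-injective)
open import Data.Fin.Subset using (Subset; ∣_∣)
open import Data.Vec using ([]; _∷_; lookup; tabulate)
open import Data.Vec.Properties using (tabulate∘lookup; tabulate-cong; lookup∘tabulate)
open import Data.List using (List; []; _∷_; map; _++_; length; filterᵇ; allFin)
open import Data.List.Properties using (length-++; length-map)
open import Data.List.Membership.Propositional using () renaming (_∈_ to _∈ₗ_)
open import Data.List.Membership.Propositional.Properties
  using (∈-∃++; ∈-++⁻; ∈-++⁺ˡ; ∈-++⁺ʳ; ∈-map⁺; ∈-map⁻; ∈-filter⁺; ∈-filter⁻; ∈-allFin)
open import Data.List.Relation.Unary.Any using (here; there; satisfied)
open import Data.List.Relation.Unary.All using (All; []; _∷_)
import Data.List.Relation.Unary.All as All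
open import Data.List.Relation.Unary.All.Properties using (all⁺; all⁻; ¬All⇒Any¬; all-filter)
import Data.List.Relation.Unary.All.Properties as All
open import Data.List.Relation.Unary.AllPairs using (_∷_)
open import Data.List.Relation.Unary.Unique.Propositional using (Unique; [])
open import Data.List.Relation.Unary.Unique.Propositional.Properties
  using (filter⁺; map⁺; ++⁺)
open import Data.Product using (_×_; _,_; ∃; ∃₂; proj₁; proj₂)
open import Data.Sum using (_⊎_; inj₁; inj₂; [_,_]′)
open import Data.Empty using (⊥; ⊥-elim)
open import Function using (_∘_)
open import Function.Bundles using (Equivalence)
open import Relation.Nullary using (¬_; Dec; yes; no)
open import Relation.Nullary.Decidable using (⌊_⌋; toWitness; fromWitness; ⌊⌋-map′)
open import Relation.Binary.PropositionalEquality
  using (_≡_; _≢_; refl; sym; trans; cong; cong₂; subst)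
open import Relation.Binary.PropositionalEquality.Properties using (module ≡-Reasoning)

-- Counting through duplicate-free enumerations

module _ {A : Set} where

  Unique-⊆⇒length≤ : ∀ {xs ys : List A} → Unique xs → (∀ {x} → x ∈ₗ xs → x ∈ₗ ys) →
                     length xs ≤ length ys
  Unique-⊆⇒length≤ {[]}     _            _     = z≤n
  Unique-⊆⇒length≤ {x ∷ xs} (x∉xs ∷ xs!) xs⊆ys with ∈-∃++ (xs⊆ys (here refl))
  ... | as , bs , refl = subst (suc (length xs) ≤_) (sym length-as++x∷bs)
                           (s≤s (Unique-⊆⇒length≤ xs! xs⊆as++bs))
    where
      xs⊆as++bs : ∀ {y} → y ∈ₗ xs → y ∈ₗ as ++ bs
      xs⊆as++bs y∈xs with ∈-++⁻ as (xs⊆ys (there y∈xs))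
      ... | inj₁ y∈as         = ∈-++⁺ˡ y∈as
      ... | inj₂ (here refl)  = ⊥-elim (All.lookup x∉xs y∈xs refl)
      ... | inj₂ (there y∈bs) = ∈-++⁺ʳ as y∈bs
      length-as++x∷bs : length (as ++ x ∷ bs) ≡ suc (length (as ++ bs))
      length-as++x∷bs = begin
        length (as ++ x ∷ bs)        ≡⟨ length-++ as ⟩
        length as + suc (length bs)  ≡⟨ +-suc (length as) (length bs) ⟩
        suc (length as + length bs)  ≡⟨ cong suc (length-++ as) ⟨
        suc (length (as ++ bs))      ∎
        where open ≡-Reasoning

  Unique-map⁺ : {P : A → Set} (φ : A → A) → (∀ {a b} → P a → P b → φ a ≡ φ b → a ≡ b) →
                ∀ {xs} → All P xs → Unique xs → Unique (map φ xs)
  Unique-map⁺         φ inj []         []           = []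
  Unique-map⁺ {P = P} φ inj (px ∷ pxs) (x∉xs ∷ xs!) = images-differ pxs x∉xs ∷ Unique-map⁺ φ inj pxs xs!
    where
      images-differ : ∀ {ys} → All P ys → All (_ ≢_) ys → All (φ _ ≢_) (map φ ys)
      images-differ []         []           = []
      images-differ (py ∷ pys) (x≢y ∷ x≢ys) = (x≢y ∘ inj px py) ∷ images-differ pys x≢ys

  filterᵇ-length-<-by-injection : {xs : List A} → Unique xs → (∀ a → a ∈ₗ xs) →
    (p q : A → Bool) (φ : A → A) →
    (∀ {a} → Bool.T (p a) → Bool.T (q (φ a))) →
    (∀ {a b} → Bool.T (p a) → Bool.T (p b) → φ a ≡ φ b → a ≡ b) →
    (m : A) → Bool.T (q m) → (∀ {a} → Bool.T (p a) → φ a ≢ m) →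
    length (filterᵇ p xs) < length (filterᵇ q xs)
  filterᵇ-length-<-by-injection {xs} xs! complete p q φ φ-q φ-inj m qm φ≢m =
    subst (_≤ length (filterᵇ q xs)) (cong suc (length-map φ (filterᵇ p xs)))
      (Unique-⊆⇒length≤ (m∉images ∷ images!) ⊆-q-elements)
    where
      p-elements : All (Bool.T ∘ p) (filterᵇ p xs)
      p-elements = all-filter (T? ∘ p) xs
      images! : Unique (map φ (filterᵇ p xs))
      images! = Unique-map⁺ φ φ-inj p-elements (filter⁺ (T? ∘ p) xs!)
      m∉images : All (m ≢_) (map φ (filterᵇ p xs))
      m∉images = All.map⁺ (All.map (λ pa → φ≢m pa ∘ sym) p-elements)
      ⊆-q-elements : ∀ {a} → a ∈ₗ m ∷ map φ (filterᵇ p xs) → a ∈ₗ filterᵇ q xs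
      ⊆-q-elements (here refl) = ∈-filter⁺ (T? ∘ q) (complete m) qm
      ⊆-q-elements (there a∈) with ∈-map⁻ φ a∈
      ... | b , b∈ , refl =
        ∈-filter⁺ (T? ∘ q) (complete (φ b)) (φ-q (proj₂ (∈-filter⁻ (T? ∘ p) {xs = xs} b∈)))

allSubsets-complete : ∀ n (C : Subset n) → C ∈ₗ allSubsets n
allSubsets-complete zero    []          = here refl
allSubsets-complete (suc n) (false ∷ C) = ∈-++⁺ˡ (∈-map⁺ (false ∷_) (allSubsets-complete n C))
allSubsets-complete (suc n) (true  ∷ C) =
  ∈-++⁺ʳ (map (false ∷_) (allSubsets n)) (∈-map⁺ (true ∷_) (allSubsets-complete n C))

allSubsets-unique : ∀ n → Unique (allSubsets n)
allSubsets-unique zero    = [] ∷ []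
allSubsets-unique (suc n) =
  ++⁺ (map⁺ ∷-injective (allSubsets-unique n)) (map⁺ ∷-injective (allSubsets-unique n)) heads-differ
  where
    ∷-injective : ∀ {b} {C D : Subset n} → b ∷ C ≡ b ∷ D → C ≡ D
    ∷-injective refl = refl
    heads-differ : ∀ {C} → ¬ (C ∈ₗ map (false ∷_) (allSubsets n) × C ∈ₗ map (true ∷_) (allSubsets n))
    heads-differ (C∈₀ , C∈₁) with ∈-map⁻ (false ∷_) C∈₀ | ∈-map⁻ (true ∷_) C∈₁
    ... | _ , _ , refl | _ , _ , ()

-- Vertex sets, as Boolean predicates: the neighbourhood of x is then E x itself, and
-- count (E x) is deg E x by definition.

VSet : ℕ → Set
VSet n = Fin n → Bool

module _ {n : ℕ} where

  infix 4 _∈_ _∉_ _⊆_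
  infixr 6 _∩_
  infixl 5 _∪_

  _∈_ : Fin n → VSet n → Set
  x ∈ P = Bool.T (P x)

  _∉_ : Fin n → VSet n → Set
  x ∉ P = ¬ x ∈ P

  _⊆_ : VSet n → VSet n → Set
  P ⊆ Q = ∀ x → x ∈ P → x ∈ Q

  _∪_ : VSet n → VSet n → VSet n
  (P ∪ Q) x = P x ∨ Q x

  _∩_ : VSet n → VSet n → VSet n
  (P ∩ Q) x = P x ∧ Q x

  ⁅_⁆ : Fin n → VSet n
  ⁅ x ⁆ y = ⌊ y ≟ x ⌋

  module _ {x : Fin n} where

    ∈-∪⁻ : ∀ P Q → x ∈ P ∪ Q → x ∈ P ⊎ x ∈ Q
    ∈-∪⁻ P Q = Equivalence.to (T-∨ {P x})

    ∈-∪⁺ˡ : ∀ P Q → x ∈ P → x ∈ P ∪ Q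
    ∈-∪⁺ˡ P Q = Equivalence.from T-∨ ∘ inj₁

    ∈-∪⁺ʳ : ∀ P Q → x ∈ Q → x ∈ P ∪ Q
    ∈-∪⁺ʳ P Q = Equivalence.from (T-∨ {P x}) ∘ inj₂

    ∈-∩⁻ : ∀ P Q → x ∈ P ∩ Q → x ∈ P × x ∈ Q
    ∈-∩⁻ P Q = Equivalence.to (T-∧ {P x})

    ∈-∩⁺ : ∀ P Q → x ∈ P → x ∈ Q → x ∈ P ∩ Q
    ∈-∩⁺ P Q x∈P x∈Q = Equivalence.from T-∧ (x∈P , x∈Q)

  module _ {x y : Fin n} where

    ∈⁅⁆⁻ : y ∈ ⁅ x ⁆ → y ≡ x
    ∈⁅⁆⁻ = toWitness

    ∈⁅⁆⁺ : y ≡ x → y ∈ ⁅ x ⁆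
    ∈⁅⁆⁺ = fromWitness

  x∈⁅x⁆ : (x : Fin n) → x ∈ ⁅ x ⁆
  x∈⁅x⁆ x = ∈⁅⁆⁺ refl

⊆-antisym : ∀ {n} {p q : Subset n} → lookup p ⊆ lookup q → lookup q ⊆ lookup p → p ≡ q
⊆-antisym {p = p} {q} p⊆q q⊆p = begin
  p                    ≡⟨ tabulate∘lookup p ⟨
  tabulate (lookup p)  ≡⟨ tabulate-cong (λ i → T-ext (p⊆q i) (q⊆p i)) ⟩
  tabulate (lookup q)  ≡⟨ tabulate∘lookup q ⟩
  q                    ∎
  where
    open ≡-Reasoning
    T-ext : ∀ {a b} → (Bool.T a → Bool.T b) → (Bool.T b → Bool.T a) → a ≡ b
    T-ext {false} {false} _   _   = refl
    T-ext {false} {true}  _   b⇒a = ⊥-elim (b⇒a _)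
    T-ext {true}  {false} a⇒b _   = ⊥-elim (a⇒b _)
    T-ext {true}  {true}  _   _   = refl

nonempty-member : ∀ {n} (p : Subset n) → 1 ≤ ∣ p ∣ → ∃ λ x → x ∈ lookup p
nonempty-member (true  ∷ p) _     = zero , _
nonempty-member (false ∷ p) 1≤∣p∣ with nonempty-member p 1≤∣p∣
... | x , x∈p = suc x , x∈p

two-members : ∀ {n} (p : Subset n) → 2 ≤ ∣ p ∣ →
              ∃₂ λ x y → x ≢ y × x ∈ lookup p × y ∈ lookup p
two-members (true  ∷ p) (s≤s 1≤∣p∣) with nonempty-member p 1≤∣p∣
... | y , y∈p = zero , suc y , (λ ()) , _ , y∈p
two-members (false ∷ p) 2≤∣p∣ with two-members p 2≤∣p∣
... | x , y , x≢y , x∈p , y∈p = suc x , suc y , x≢y ∘ suc-injective , x∈p , y∈p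

count : ∀ {n} → VSet n → ℕ
count P = ∣ tabulate P ∣

count-lookup : ∀ {n} (p : Subset n) → count (lookup p) ≡ ∣ p ∣
count-lookup p = cong ∣_∣ (tabulate∘lookup p)

count-mono : ∀ {n} {P Q : VSet n} → P ⊆ Q → count P ≤ count Q
count-mono {zero}          _   = z≤n
count-mono {suc n} {P} {Q} P⊆Q =
  cons-mono (P zero) (Q zero) (tabulate (P ∘ suc)) (tabulate (Q ∘ suc)) (P⊆Q zero)
    (count-mono (P⊆Q ∘ suc))
  where
    cons-mono : ∀ a b {m} (p q : Subset m) → (Bool.T a → Bool.T b) → ∣ p ∣ ≤ ∣ q ∣ →
                ∣ a ∷ p ∣ ≤ ∣ b ∷ q ∣
    cons-mono true  true  _ _ _ p≤q = s≤s p≤q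
    cons-mono true  false _ _ h _   = ⊥-elim (h _)
    cons-mono false true  _ _ _ p≤q = m≤n⇒m≤1+n p≤q
    cons-mono false false _ _ _ p≤q = p≤q

count-∪+count-∩ : ∀ {n} (P Q : VSet n) → count (P ∪ Q) + count (P ∩ Q) ≡ count P + count Q
count-∪+count-∩ {zero}  P Q = refl
count-∪+count-∩ {suc n} P Q =
  cons (P zero) (Q zero) (tabulate (P ∘ suc)) (tabulate (Q ∘ suc))
       (tabulate ((P ∪ Q) ∘ suc)) (tabulate ((P ∩ Q) ∘ suc))
    (count-∪+count-∩ (P ∘ suc) (Q ∘ suc))
  where
    cons : ∀ a b {m} (p q s t : Subset m) → ∣ s ∣ + ∣ t ∣ ≡ ∣ p ∣ + ∣ q ∣ →
           ∣ (a ∨ b) ∷ s ∣ + ∣ (a ∧ b) ∷ t ∣ ≡ ∣ a ∷ p ∣ + ∣ b ∷ q ∣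
    cons true  true  p q s _ eq =
      cong suc (trans (+-suc ∣ s ∣ _) (trans (cong suc eq) (sym (+-suc ∣ p ∣ ∣ q ∣))))
    cons true  false _ _ _ _ eq = cong suc eq
    cons false true  p q _ _ eq = trans (cong suc eq) (sym (+-suc ∣ p ∣ ∣ q ∣))
    cons false false _ _ _ _ eq = eq

count-∅ : ∀ {n} → count {n} (λ _ → false) ≡ 0
count-∅ {zero}  = refl
count-∅ {suc n} = count-∅ {n}

count-⁅⁆ : ∀ {n} (x : Fin n) → count ⁅ x ⁆ ≡ 1
count-⁅⁆ {suc n} zero    = cong suc (count-∅ {n})
count-⁅⁆ {suc n} (suc x) =
  trans (cong ∣_∣ (tabulate-cong λ i → ⌊⌋-map′ _ _ (i ≟ x))) (count-⁅⁆ x)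

count-∪-≤ : ∀ {n} (P Q : VSet n) → count (P ∪ Q) ≤ count P + count Q
count-∪-≤ P Q = ≤-trans (m≤m+n _ _) (≤-reflexive (count-∪+count-∩ P Q))

count-∪-disjoint : ∀ {n} {P Q : VSet n} → (∀ {x} → x ∈ P → x ∉ Q) →
                   count (P ∪ Q) ≡ count P + count Q
count-∪-disjoint {n} {P} {Q} disjoint = begin
  count (P ∪ Q)                  ≡⟨ +-identityʳ _ ⟨
  count (P ∪ Q) + 0              ≡⟨ cong (count (P ∪ Q) +_) count-∩≡0 ⟨
  count (P ∪ Q) + count (P ∩ Q)  ≡⟨ count-∪+count-∩ P Q ⟩
  count P + count Q              ∎
  where
    open ≡-Reasoning
    count-∩≡0 : count (P ∩ Q) ≡ 0
    count-∩≡0 = n≤0⇒n≡0 (≤-trans (count-mono P∩Q⊆∅) (≤-reflexive (count-∅ {n})))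
      where
        P∩Q⊆∅ : P ∩ Q ⊆ (λ _ → false)
        P∩Q⊆∅ _ x∈P∩Q = let x∈P , x∈Q = ∈-∩⁻ P Q x∈P∩Q in disjoint x∈P x∈Q

count-∪-⁅⁆ : ∀ {n} (P : VSet n) {x} → x ∉ P → count (P ∪ ⁅ x ⁆) ≡ suc (count P)
count-∪-⁅⁆ P {x} x∉P = begin
  count (P ∪ ⁅ x ⁆)       ≡⟨ count-∪-disjoint {P = P} {⁅ x ⁆}
                               (λ y∈P y∈⁅x⁆ → x∉P (subst (_∈ P) (∈⁅⁆⁻ y∈⁅x⁆) y∈P)) ⟩
  count P + count ⁅ x ⁆   ≡⟨ cong (count P +_) (count-⁅⁆ x) ⟩
  count P + 1             ≡⟨ +-comm (count P) 1 ⟩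
  suc (count P)           ∎
  where open ≡-Reasoning

count-∪-⁅⁆-≤ : ∀ {n} (P : VSet n) x → count (P ∪ ⁅ x ⁆) ≤ suc (count P)
count-∪-⁅⁆-≤ P x = ≤-trans (count-∪-≤ P ⁅ x ⁆)
  (≤-reflexive (trans (cong (count P +_) (count-⁅⁆ x)) (+-comm (count P) 1)))

IsClique : ∀ {n} → Adj n → VSet n → Set
IsClique E P = ∀ {x y} → x ∈ P → y ∈ P → x ≢ y → y ∈ E x

module _ {n : ℕ} (E : Adj n) (C : Subset n) where

  private
    pairOk : Fin n → Fin n → Bool
    pairOk x y = not (x ∈ᵇ C ∧ y ∈ᵇ C ∧ not ⌊ x ≟ y ⌋) ∨ E x y

    pairOk⁻ : ∀ a b d e → Bool.T (not (a ∧ b ∧ not d) ∨ e) →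
              Bool.T a → Bool.T b → ¬ Bool.T d → Bool.T e
    pairOk⁻ true true false e ok _ _ _ = ok
    pairOk⁻ true true true  e _  _ _ ¬d = ⊥-elim (¬d _)

    pairOk⁺ : ∀ a b d e → (Bool.T a → Bool.T b → ¬ Bool.T d → Bool.T e) →
              Bool.T (not (a ∧ b ∧ not d) ∨ e)
    pairOk⁺ true  true  false e h = h _ _ λ ()
    pairOk⁺ true  true  true  e h = _
    pairOk⁺ true  false d     e h = _
    pairOk⁺ false b     d     e h = _

    pairOk-violated : ∀ a b d e → ¬ Bool.T (not (a ∧ b ∧ not d) ∨ e) →
                      Bool.T a × Bool.T b × ¬ Bool.T d × ¬ Bool.T e
    pairOk-violated true  true  false false _   = _ , _ , (λ ()) , λ ()
    pairOk-violated true  true  false true  bad = ⊥-elim (bad _)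
    pairOk-violated true  true  true  e     bad = ⊥-elim (bad _)
    pairOk-violated true  false d     e     bad = ⊥-elim (bad _)
    pairOk-violated false b     d     e     bad = ⊥-elim (bad _)

    failing : (p : Fin n → Bool) → ¬ Bool.T (all p (allFin n)) → ∃ λ x → ¬ Bool.T (p x)
    failing p bad = satisfied (¬All⇒Any¬ (T? ∘ p) (allFin n) (bad ∘ all⁻ p))

    allPairsOk : Bool.T (isClique E C) → ∀ x y → Bool.T (pairOk x y)
    allPairsOk cl x y = All.lookup (all⁺ (pairOk x) _ (All.lookup (all⁺ _ _ cl) (∈-allFin x))) (∈-allFin y)

  isClique-sound : Bool.T (isClique E C) → IsClique E (lookup C)
  isClique-sound cl {x} {y} x∈C y∈C x≢y =
    pairOk⁻ (x ∈ᵇ C) (y ∈ᵇ C) ⌊ x ≟ y ⌋ (E x y) (allPairsOk cl x y) x∈C y∈C (x≢y ∘ toWitness)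

  isClique-complete : IsClique E (lookup C) → Bool.T (isClique E C)
  isClique-complete clique =
    all⁻ (λ x → all (pairOk x) (allFin n)) {xs = allFin n} (All.tabulate λ {x} _ →
      all⁻ (pairOk x) {xs = allFin n} (All.tabulate λ {y} _ →
        pairOk⁺ (x ∈ᵇ C) (y ∈ᵇ C) ⌊ x ≟ y ⌋ (E x y) λ x∈C y∈C x≢y →
          clique x∈C y∈C (x≢y ∘ fromWitness)))

  isClique-witness : ¬ Bool.T (isClique E C) →
    ∃₂ λ x y → x ∈ lookup C × y ∈ lookup C × x ≢ y × y ∉ E x
  isClique-witness notClique with failing (λ x → all (pairOk x) (allFin n)) notClique
  ... | x , bad with failing (pairOk x) bad
  ... | y , bad′ with pairOk-violated (x ∈ᵇ C) (y ∈ᵇ C) ⌊ x ≟ y ⌋ (E x y) bad′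
  ... | x∈C , y∈C , x≉y , y∉Ex = x , y , x∈C , y∈C , x≉y ∘ fromWitness , y∉Ex

-- Rewiring

rewire : ∀ {n} → VSet n → VSet n → Adj n → Adj n
rewire U W E x y =
  if U x ∧ U y ∧ not ⌊ x ≟ y ⌋ then true
  else if (U x ∧ not (W y)) ∨ (U y ∧ not (W x)) then false
  else E x y

module _ {n : ℕ} (U W : VSet n) (E : Adj n) where

  private
    E′ : Adj n
    E′ = rewire U W E

    kept : ∀ a {e} → Bool.T e → Bool.T (if a then true else e)
    kept true  _  = _
    kept false e  = e

  rewire-⊆ : ∀ {x} → x ∉ U → E′ x ⊆ E x
  rewire-⊆ {x} x∉U y y∈E′x with U x | U y | W x
  ... | true  | _     | _     = ⊥-elim (x∉U _)
  ... | false | true  | false = ⊥-elim y∈E′x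
  ... | false | true  | true  = y∈E′x
  ... | false | false | _     = y∈E′x

  rewire-nbrs : ∀ {x} → x ∈ U → E′ x ⊆ U ∪ W
  rewire-nbrs {x} x∈U y y∈E′x with U x | U y | W y
  rewire-nbrs () _ _ | false | _     | _
  ... | true | true  | _     = _
  ... | true | false | true  = _
  ... | true | false | false = ⊥-elim y∈E′x

  rewire-irreflexive : Irreflexive E → Irreflexive E′
  rewire-irreflexive irr x with U x | x ≟ x | W x
  ... | false | _      | _     = irr x
  ... | true  | no x≢x | _     = ⊥-elim (x≢x refl)
  ... | true  | yes _  | false = refl
  ... | true  | yes _  | true  = irr x

  rewire-lost-edge : ∀ {x y} → y ∈ E x → y ∉ E′ x → (x ∈ U × y ∉ W) ⊎ (y ∈ U × x ∉ W)
  rewire-lost-edge {x} {y} y∈Ex y∉E′x with U x | W y | U y | W x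
  ... | true  | false | _     | _     = inj₁ (_ , λ ())
  ... | _     | _     | true  | false = inj₂ (_ , λ ())
  ... | true  | true  | true  | true  = ⊥-elim (y∉E′x (kept (not ⌊ x ≟ y ⌋) y∈Ex))
  ... | true  | true  | false | _     = ⊥-elim (y∉E′x y∈Ex)
  ... | false | _     | true  | true  = ⊥-elim (y∉E′x y∈Ex)
  ... | false | _     | false | _     = ⊥-elim (y∉E′x y∈Ex)

  rewire-U-edge : ∀ {x y} → x ∈ U → y ∈ U → x ≢ y → y ∈ E′ x
  rewire-U-edge {x} {y} x∈U y∈U x≢y with U x | U y | x ≟ y
  rewire-U-edge () _ _ | false | _     | _
  rewire-U-edge _ () _ | true  | false | _
  ... | true | true | yes x≡y = ⊥-elim (x≢y x≡y)
  ... | true | true | no _    = _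

  rewire-W-edge : ∀ {x y} → x ∈ W → y ∈ W → y ∈ E x → y ∈ E′ x
  rewire-W-edge {x} {y} x∈W y∈W y∈Ex with W x | W y | U x | U y
  rewire-W-edge () _ _ | false | _     | _     | _
  rewire-W-edge _ () _ | true  | false | _     | _
  ... | true | true | true  | true  = kept (not ⌊ x ≟ y ⌋) y∈Ex
  ... | true | true | true  | false = y∈Ex
  ... | true | true | false | true  = y∈Ex
  ... | true | true | false | false = y∈Ex

-- Tight cliques

module TightClique {n r : ℕ} (E : Adj n) (symE : Symmetric E) (irrE : Irreflexive E)
                   (Δ≤r : MaxDeg≤ E r) (T : Subset n) (tight : Tight E r T) where

  S : VSet n
  S = lookup (commonNbrs E T)

  TS : VSet n
  TS = lookup T ∪ S

  adj-sym : ∀ {x y} → y ∈ E x → x ∈ E y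
  adj-sym {x} {y} = subst Bool.T (symE x y)

  adj-irrefl : ∀ x → x ∉ E x
  adj-irrefl x = subst Bool.T (irrE x)

  T-clique : IsClique E (lookup T)
  T-clique = isClique-sound E T (Equivalence.from T-≡ (proj₁ tight))

  S-common : ∀ {z x} → z ∈ S → x ∈ lookup T → z ∈ E x
  S-common {z} {x} z∈S x∈T =
    implied (x ∈ᵇ T) (E x z) x∈T
      (All.lookup (all⁺ _ (allFin n) (subst Bool.T (lookup∘tabulate (commonNbrᵇ E T) z) z∈S)) (∈-allFin x))
    where
      implied : ∀ a e → Bool.T a → Bool.T (not a ∨ e) → Bool.T e
      implied true e _ e-holds = e-holds

  T∉S : ∀ {x} → x ∈ lookup T → x ∉ S
  T∉S x∈T x∈S = adj-irrefl _ (S-common x∈S x∈T)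

  closedNbr-count : ∀ x → count (E x ∪ ⁅ x ⁆) ≤ suc r
  closedNbr-count x = ≤-trans (count-∪-⁅⁆-≤ (E x) x) (s≤s (Δ≤r x))

  T⊆closedNbr : ∀ {x} → x ∈ lookup T → lookup T ⊆ E x ∪ ⁅ x ⁆
  T⊆closedNbr {x} x∈T y y∈T = by-cases (y ≟ x)
    where
      by-cases : Dec (y ≡ x) → y ∈ E x ∪ ⁅ x ⁆
      by-cases (yes y≡x) = ∈-∪⁺ʳ (E x) ⁅ x ⁆ (∈⁅⁆⁺ y≡x)
      by-cases (no  y≢x) = ∈-∪⁺ˡ (E x) ⁅ x ⁆ (T-clique {x} {y} x∈T y∈T (y≢x ∘ sym))

  ∣T∣≤1+r : ∣ T ∣ ≤ suc r
  ∣T∣≤1+r with nonempty-member T (proj₁ (proj₂ tight))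
  ... | x , x∈T = begin
    ∣ T ∣                 ≡⟨ count-lookup T ⟨
    count (lookup T)      ≤⟨ count-mono (T⊆closedNbr x∈T) ⟩
    count (E x ∪ ⁅ x ⁆)   ≤⟨ closedNbr-count x ⟩
    suc r                 ∎
    where open ≤-Reasoning

  -- ∣T∣≤1+r is needed because r + 1 ∸ ∣ T ∣ is truncated subtraction.
  count-TS : count TS ≡ suc r
  count-TS = begin
    count TS                    ≡⟨ count-∪-disjoint {P = lookup T} {S} T∉S ⟩
    count (lookup T) + count S  ≡⟨ cong₂ _+_ (count-lookup T)
                                     (trans (count-lookup (commonNbrs E T)) (proj₂ (proj₂ tight))) ⟩
    ∣ T ∣ + (r + 1 ∸ ∣ T ∣)     ≡⟨ m+[n∸m]≡n (≤-trans ∣T∣≤1+r (≤-reflexive (+-comm 1 r))) ⟩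
    r + 1                       ≡⟨ +-comm r 1 ⟩
    suc r                       ∎
    where open ≡-Reasoning

  -- Otherwise the closed neighbourhood of x, of size at most r + 1, would contain T ∪ S,
  -- of size r + 1, and one more vertex.
  T-nbrs⊆TS : ∀ {x} → x ∈ lookup T → E x ⊆ TS
  T-nbrs⊆TS {x} x∈T z z∈Ex with T? (TS z)
  ... | yes z∈TS = z∈TS
  ... | no  z∉TS = ⊥-elim (<-irrefl refl too-many)
    where
      TS+z⊆closedNbr : TS ∪ ⁅ z ⁆ ⊆ E x ∪ ⁅ x ⁆
      TS+z⊆closedNbr i i∈ with ∈-∪⁻ TS ⁅ z ⁆ i∈
      ... | inj₂ i≡z = ∈-∪⁺ˡ (E x) ⁅ x ⁆ (subst (_∈ E x) (sym (∈⁅⁆⁻ i≡z)) z∈Ex)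
      ... | inj₁ i∈TS with ∈-∪⁻ (lookup T) S i∈TS
      ...   | inj₁ i∈T = T⊆closedNbr x∈T i i∈T
      ...   | inj₂ i∈S = ∈-∪⁺ˡ (E x) ⁅ x ⁆ (S-common i∈S x∈T)
      too-many : suc (suc r) ≤ suc r
      too-many = begin
        suc (suc r)           ≡⟨ cong suc count-TS ⟨
        suc (count TS)        ≡⟨ count-∪-⁅⁆ TS z∉TS ⟨
        count (TS ∪ ⁅ z ⁆)    ≤⟨ count-mono TS+z⊆closedNbr ⟩
        count (E x ∪ ⁅ x ⁆)   ≤⟨ closedNbr-count x ⟩
        suc r                 ∎
        where open ≤-Reasoning

  module Rewiring (u v : Fin n) (K2 : K2ComponentOfR E T u v) where

    UV : VSet n
    UV = ⁅ u ⁆ ∪ ⁅ v ⁆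

    -- Unfolds to rewire UV TS E, so the rewiring lemmas apply to it directly.
    E′ : Adj n
    E′ = modify E T u v

    private
      u≢v : u ≢ v
      u≢v = proj₁ K2

      u∈S : u ∈ S
      u∈S = Equivalence.from T-≡ (proj₁ (proj₂ K2))

      v∈S : v ∈ S
      v∈S = Equivalence.from T-≡ (proj₁ (proj₂ (proj₂ K2)))

      v∉Eu : v ∉ E u
      v∉Eu = subst Bool.T (proj₁ (proj₂ (proj₂ (proj₂ K2))))

      UV-adjacent : ∀ {z} → z ∈ S → z ≢ u → z ≢ v → u ∈ E z × v ∈ E z
      UV-adjacent {z} z∈S z≢u z≢v =
        let Ezu , Ezv = proj₂ (proj₂ (proj₂ (proj₂ K2))) z (Equivalence.to T-≡ z∈S) z≢u z≢v
        in Equivalence.from T-≡ Ezu , Equivalence.from T-≡ Ezv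

    UV⊆S : UV ⊆ S
    UV⊆S w w∈UV with ∈-∪⁻ ⁅ u ⁆ ⁅ v ⁆ w∈UV
    ... | inj₁ w≡u = subst (_∈ S) (sym (∈⁅⁆⁻ w≡u)) u∈S
    ... | inj₂ w≡v = subst (_∈ S) (sym (∈⁅⁆⁻ w≡v)) v∈S

    UV-independent : ∀ {a b} → a ∈ UV → b ∈ UV → a ≢ b → b ∉ E a
    UV-independent {a} {b} a∈UV b∈UV a≢b
      with ∈-∪⁻ ⁅ u ⁆ ⁅ v ⁆ a∈UV | ∈-∪⁻ ⁅ u ⁆ ⁅ v ⁆ b∈UV
    ... | inj₁ a≡u | inj₁ b≡u = ⊥-elim (a≢b (trans (∈⁅⁆⁻ a≡u) (sym (∈⁅⁆⁻ b≡u))))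
    ... | inj₂ a≡v | inj₂ b≡v = ⊥-elim (a≢b (trans (∈⁅⁆⁻ a≡v) (sym (∈⁅⁆⁻ b≡v))))
    ... | inj₁ a≡u | inj₂ b≡v rewrite ∈⁅⁆⁻ a≡u | ∈⁅⁆⁻ b≡v = v∉Eu
    ... | inj₂ a≡v | inj₁ b≡u rewrite ∈⁅⁆⁻ a≡v | ∈⁅⁆⁻ b≡u = v∉Eu ∘ adj-sym

    S-adjacent-UV : ∀ {z w} → z ∈ S → z ∉ UV → w ∈ UV → w ∈ E z
    S-adjacent-UV {z} {w} z∈S z∉UV w∈UV
      with UV-adjacent z∈S (z∉UV ∘ ∈-∪⁺ˡ ⁅ u ⁆ ⁅ v ⁆ ∘ ∈⁅⁆⁺)
                           (z∉UV ∘ ∈-∪⁺ʳ ⁅ u ⁆ ⁅ v ⁆ ∘ ∈⁅⁆⁺)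
         | ∈-∪⁻ ⁅ u ⁆ ⁅ v ⁆ w∈UV
    ... | u∈Ez , _ | inj₁ w≡u = subst (_∈ E z) (sym (∈⁅⁆⁻ w≡u)) u∈Ez
    ... | _ , v∈Ez | inj₂ w≡v = subst (_∈ E z) (sym (∈⁅⁆⁻ w≡v)) v∈Ez

    u∈UV : u ∈ UV
    u∈UV = ∈-∪⁺ˡ ⁅ u ⁆ ⁅ v ⁆ (x∈⁅x⁆ u)

    v∈UV : v ∈ UV
    v∈UV = ∈-∪⁺ʳ ⁅ u ⁆ ⁅ v ⁆ (x∈⁅x⁆ v)

    no-clique-contains-UV : ∀ {P} → IsClique E P → UV ⊆ P → ⊥
    no-clique-contains-UV {P} clique UV⊆P =
      UV-independent u∈UV v∈UV u≢v (clique {u} {v} (UV⊆P u u∈UV) (UV⊆P v v∈UV) u≢v)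

    UV⊆TS : UV ⊆ TS
    UV⊆TS w = ∈-∪⁺ʳ (lookup T) S ∘ UV⊆S w

    TS⊆nbrs∪UV : ∀ {w} → w ∈ UV → TS ⊆ E w ∪ UV
    TS⊆nbrs∪UV {w} w∈UV i i∈TS with ∈-∪⁻ (lookup T) S i∈TS
    ... | inj₁ i∈T = ∈-∪⁺ˡ (E w) UV (adj-sym (S-common (UV⊆S w w∈UV) i∈T))
    ... | inj₂ i∈S with T? (UV i)
    ...   | yes i∈UV = ∈-∪⁺ʳ (E w) UV i∈UV
    ...   | no  i∉UV = ∈-∪⁺ˡ (E w) UV (adj-sym (S-adjacent-UV i∈S i∉UV w∈UV))

    count-UV≤2 : count UV ≤ 2
    count-UV≤2 =
      ≤-trans (count-∪-≤ ⁅ u ⁆ ⁅ v ⁆) (≤-reflexive (cong₂ _+_ (count-⁅⁆ u) (count-⁅⁆ v)))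

    -- E w ∪ UV has at most r + 2 elements and already contains T ∪ S, of size r + 1.
    UV-outer-nbr-unique : ∀ {w o o′} → w ∈ UV → o ∈ E w → o′ ∈ E w →
                          o ∉ TS → o′ ∉ TS → o ≡ o′
    UV-outer-nbr-unique {w} {o} {o′} w∈UV o∈Ew o′∈Ew o∉TS o′∉TS with o ≟ o′
    ... | yes o≡o′ = o≡o′
    ... | no  o≢o′ = ⊥-elim (<-irrefl refl too-many)
      where
        o′∉TS+o : o′ ∉ TS ∪ ⁅ o ⁆
        o′∉TS+o o′∈ with ∈-∪⁻ TS ⁅ o ⁆ o′∈
        ... | inj₁ o′∈TS = o′∉TS o′∈TS
        ... | inj₂ o′≡o  = o≢o′ (sym (∈⁅⁆⁻ o′≡o))
        ⊆nbrs∪UV : TS ∪ ⁅ o ⁆ ∪ ⁅ o′ ⁆ ⊆ E w ∪ UV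
        ⊆nbrs∪UV i i∈ with ∈-∪⁻ (TS ∪ ⁅ o ⁆) ⁅ o′ ⁆ i∈
        ... | inj₂ i≡o′ = ∈-∪⁺ˡ (E w) UV (subst (_∈ E w) (sym (∈⁅⁆⁻ i≡o′)) o′∈Ew)
        ... | inj₁ i∈TS+o with ∈-∪⁻ TS ⁅ o ⁆ i∈TS+o
        ...   | inj₁ i∈TS = TS⊆nbrs∪UV w∈UV i i∈TS
        ...   | inj₂ i≡o  = ∈-∪⁺ˡ (E w) UV (subst (_∈ E w) (sym (∈⁅⁆⁻ i≡o)) o∈Ew)
        too-many : suc (2 + r) ≤ 2 + r
        too-many = begin
          3 + r                          ≡⟨ cong (2 +_) count-TS ⟨
          2 + count TS                   ≡⟨ cong suc (count-∪-⁅⁆ TS o∉TS) ⟨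
          suc (count (TS ∪ ⁅ o ⁆))       ≡⟨ count-∪-⁅⁆ (TS ∪ ⁅ o ⁆) o′∉TS+o ⟨
          count (TS ∪ ⁅ o ⁆ ∪ ⁅ o′ ⁆)    ≤⟨ count-mono ⊆nbrs∪UV ⟩
          count (E w ∪ UV)               ≤⟨ count-∪-≤ (E w) UV ⟩
          count (E w) + count UV         ≤⟨ +-mono-≤ (Δ≤r w) count-UV≤2 ⟩
          r + 2                          ≡⟨ +-comm r 2 ⟩
          2 + r                          ∎
          where open ≤-Reasoning

    rewired-Δ≤r : MaxDeg≤ E′ r
    rewired-Δ≤r x with T? (UV x)
    ... | no  x∉UV = ≤-trans (count-mono (rewire-⊆ UV TS E x∉UV)) (Δ≤r x)
    ... | yes x∈UV = ≤-pred (begin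
      suc (count (E′ x))      ≡⟨ count-∪-⁅⁆ (E′ x) x∉E′x ⟨
      count (E′ x ∪ ⁅ x ⁆)    ≤⟨ count-mono closedNbr⊆TS ⟩
      count TS                ≡⟨ count-TS ⟩
      suc r                   ∎)
      where
        open ≤-Reasoning
        x∉E′x : x ∉ E′ x
        x∉E′x = subst Bool.T (rewire-irreflexive UV TS E irrE x)
        closedNbr⊆TS : E′ x ∪ ⁅ x ⁆ ⊆ TS
        closedNbr⊆TS i i∈ with ∈-∪⁻ (E′ x) ⁅ x ⁆ i∈
        ... | inj₂ i≡x = UV⊆TS i (subst (_∈ UV) (sym (∈⁅⁆⁻ i≡x)) x∈UV)
        ... | inj₁ i∈E′x with ∈-∪⁻ UV TS (rewire-nbrs UV TS E {x} x∈UV i i∈E′x)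
        ...   | inj₁ i∈UV = UV⊆TS i i∈UV
        ...   | inj₂ i∈TS = i∈TS

    record Lost (C : Subset n) : Set where
      constructor lost
      field
        clique   : Bool.T (isClique E C)
        ¬clique′ : ¬ Bool.T (isClique E′ C)

    ContainsCutEdge : Subset n → Set
    ContainsCutEdge C = ∃₂ λ w o → w ∈ lookup C × w ∈ UV × o ∈ lookup C × o ∉ TS

    lost-cut-edge : ∀ {C} → Lost C → ContainsCutEdge C
    lost-cut-edge {C} (lost cl ¬cl′) = orient (isClique-witness E′ C ¬cl′)
      where
        orient : (∃₂ λ x y → x ∈ lookup C × y ∈ lookup C × x ≢ y × y ∉ E′ x) → ContainsCutEdge C
        orient (x , y , x∈C , y∈C , x≢y , y∉E′x)
          with rewire-lost-edge UV TS E {x} {y} (isClique-sound E C cl {x} {y} x∈C y∈C x≢y) y∉E′x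
        ... | inj₁ (x∈UV , y∉TS) = x , y , x∈C , x∈UV , y∈C , y∉TS
        ... | inj₂ (y∈UV , x∉TS) = y , x , y∈C , y∈UV , x∈C , x∉TS

    TS-separates : ∀ {x y} → x ∈ TS → y ∉ TS → x ≢ y
    TS-separates x∈TS y∉TS refl = y∉TS x∈TS

    lost-avoids-T : ∀ {C y} → Lost C → y ∈ lookup C → y ∉ lookup T
    lost-avoids-T {C} {y} C-lost y∈C y∈T = contradiction (lost-cut-edge C-lost)
      where
        contradiction : ContainsCutEdge C → ⊥
        contradiction (_ , o , _ , _ , o∈C , o∉TS) =
          o∉TS (T-nbrs⊆TS y∈T o (isClique-sound E C (Lost.clique C-lost) {y} {o} y∈C o∈C
                                   (TS-separates (∈-∪⁺ˡ (lookup T) S y∈T) o∉TS)))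

    lost-outside-agree : ∀ {C D w} → Lost C → Lost D → w ∈ UV → w ∈ lookup C → w ∈ lookup D →
                         ∀ i → i ∉ TS → i ∈ lookup C → i ∈ lookup D
    lost-outside-agree {C} {D} {w} lostC lostD w∈UV w∈C w∈D i i∉TS i∈C = via (lost-cut-edge lostD)
      where
        i∈Ew : i ∈ E w
        i∈Ew = isClique-sound E C (Lost.clique lostC) {w} {i} w∈C i∈C (TS-separates (UV⊆TS w w∈UV) i∉TS)
        via : ContainsCutEdge D → i ∈ lookup D
        via (_ , o , _ , _ , o∈D , o∉TS) =
          subst (_∈ lookup D) (sym (UV-outer-nbr-unique w∈UV i∈Ew o∈Ew i∉TS o∉TS)) o∈D
          where
            o∈Ew : o ∈ E w
            o∈Ew = isClique-sound E D (Lost.clique lostD) {w} {o} w∈D o∈D (TS-separates (UV⊆TS w w∈UV) o∉TS)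

    lost-meets-UV : ∀ {C} → Lost C → u ∉ lookup C → v ∈ lookup C
    lost-meets-UV {C} C-lost u∉C = via (lost-cut-edge C-lost)
      where
        via : ContainsCutEdge C → v ∈ lookup C
        via (w , _ , w∈C , w∈UV , _) =
          [ (λ w≡u → ⊥-elim (u∉C (subst (_∈ lookup C) (∈⁅⁆⁻ w≡u) w∈C)))
          , (λ w≡v → subst (_∈ lookup C) (∈⁅⁆⁻ w≡v) w∈C)
          ]′ (∈-∪⁻ ⁅ u ⁆ ⁅ v ⁆ w∈UV)

    -- A lost clique meets T ∪ S only in S, so its transfer trades its vertex outside
    -- T ∪ S for u, v and the vertex x of T.
    transfer : Subset n → Fin n → Subset n
    transfer C x = tabulate (lookup C ∩ S ∪ UV ∪ ⁅ x ⁆)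

    Core : Subset n → Fin n → Set
    Core C i = i ∈ S × (i ∈ lookup C ⊎ i ∈ UV)

    ∈-transfer⁻ : ∀ C x {i} → i ∈ lookup (transfer C x) → Core C i ⊎ i ≡ x
    ∈-transfer⁻ C x {i} i∈
      with ∈-∪⁻ (lookup C ∩ S ∪ UV) ⁅ x ⁆ (subst Bool.T (lookup∘tabulate (lookup C ∩ S ∪ UV ∪ ⁅ x ⁆) i) i∈)
    ... | inj₂ i≡x = inj₂ (∈⁅⁆⁻ i≡x)
    ... | inj₁ i∈ with ∈-∪⁻ (lookup C ∩ S) UV i∈
    ...   | inj₂ i∈UV = inj₁ (UV⊆S i i∈UV , inj₂ i∈UV)
    ...   | inj₁ i∈C∩S = let i∈C , i∈S = ∈-∩⁻ (lookup C) S i∈C∩S in inj₁ (i∈S , inj₁ i∈C)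

    ∈-transfer⁺ : ∀ C x {i} → (i ∈ lookup C × i ∈ S) ⊎ i ∈ UV ⊎ i ≡ x →
                  i ∈ lookup (transfer C x)
    ∈-transfer⁺ C x {i} member =
      subst Bool.T (sym (lookup∘tabulate (lookup C ∩ S ∪ UV ∪ ⁅ x ⁆) i)) (by-cases member)
      where
        by-cases : (i ∈ lookup C × i ∈ S) ⊎ i ∈ UV ⊎ i ≡ x → i ∈ lookup C ∩ S ∪ UV ∪ ⁅ x ⁆
        by-cases (inj₁ (i∈C , i∈S)) =
          ∈-∪⁺ˡ (lookup C ∩ S ∪ UV) ⁅ x ⁆ (∈-∪⁺ˡ (lookup C ∩ S) UV (∈-∩⁺ (lookup C) S i∈C i∈S))
        by-cases (inj₂ (inj₁ i∈UV)) =
          ∈-∪⁺ˡ (lookup C ∩ S ∪ UV) ⁅ x ⁆ (∈-∪⁺ʳ (lookup C ∩ S) UV i∈UV)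
        by-cases (inj₂ (inj₂ i≡x))  = ∈-∪⁺ʳ (lookup C ∩ S ∪ UV) ⁅ x ⁆ (∈⁅⁆⁺ i≡x)

    core-adjacent : ∀ {C i j} → IsClique E (lookup C) → Core C i → Core C j → i ≢ j →
                    ¬ (i ∈ UV × j ∈ UV) → j ∈ E i
    core-adjacent {C} {i} {j} clique (i∈S , i∈C⊎UV) (j∈S , j∈C⊎UV) i≢j not-both
      with T? (UV i) | T? (UV j)
    ... | yes i∈UV | yes j∈UV = ⊥-elim (not-both (i∈UV , j∈UV))
    ... | no  i∉UV | yes j∈UV = S-adjacent-UV i∈S i∉UV j∈UV
    ... | yes i∈UV | no  j∉UV = adj-sym (S-adjacent-UV j∈S j∉UV i∈UV)
    ... | no  i∉UV | no  j∉UV = clique (in-C i∈C⊎UV i∉UV) (in-C j∈C⊎UV j∉UV) i≢j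
      where
        in-C : ∀ {k} → k ∈ lookup C ⊎ k ∈ UV → k ∉ UV → k ∈ lookup C
        in-C (inj₁ k∈C)  _    = k∈C
        in-C (inj₂ k∈UV) k∉UV = ⊥-elim (k∉UV k∈UV)

    transfer-clique : ∀ C x → IsClique E (lookup C) → x ∈ lookup T → Bool.T (isClique E′ (transfer C x))
    transfer-clique C x clique x∈T = isClique-complete E′ (transfer C x) adjacent′
      where
        in-TS : ∀ {i} → Core C i ⊎ i ≡ x → i ∈ TS
        in-TS (inj₁ (i∈S , _)) = ∈-∪⁺ʳ (lookup T) S i∈S
        in-TS (inj₂ refl)      = ∈-∪⁺ˡ (lookup T) S x∈T
        adjacent : ∀ {i j} → Core C i ⊎ i ≡ x → Core C j ⊎ j ≡ x → i ≢ j →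
                   ¬ (i ∈ UV × j ∈ UV) → j ∈ E i
        adjacent (inj₁ core-i)    (inj₁ core-j)    i≢j not-both = core-adjacent {C} clique core-i core-j i≢j not-both
        adjacent (inj₁ (i∈S , _)) (inj₂ refl)      _   _        = adj-sym (S-common i∈S x∈T)
        adjacent (inj₂ refl)      (inj₁ (j∈S , _)) _   _        = S-common j∈S x∈T
        adjacent (inj₂ refl)      (inj₂ refl)      i≢j _        = ⊥-elim (i≢j refl)
        adjacent′ : IsClique E′ (lookup (transfer C x))
        adjacent′ {i} {j} i∈ j∈ i≢j
          with ∈-transfer⁻ C x i∈ | ∈-transfer⁻ C x j∈ | T? (UV i) | T? (UV j)
        ... | _  | _  | yes i∈UV | yes j∈UV = rewire-U-edge UV TS E i∈UV j∈UV i≢j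
        ... | mi | mj | no  i∉UV | _        =
          rewire-W-edge UV TS E (in-TS mi) (in-TS mj) (adjacent mi mj i≢j (i∉UV ∘ proj₁))
        ... | mi | mj | yes _    | no  j∉UV =
          rewire-W-edge UV TS E (in-TS mi) (in-TS mj) (adjacent mi mj i≢j (j∉UV ∘ proj₂))

    transfer-meets-T : ∀ C x {y} → y ∈ lookup T → y ∈ lookup (transfer C x) → y ≡ x
    transfer-meets-T C x y∈T y∈ with ∈-transfer⁻ C x y∈
    ... | inj₁ (y∈S , _) = ⊥-elim (T∉S y∈T y∈S)
    ... | inj₂ y≡x       = y≡x

    transfer-not-clique : ∀ C x → ¬ Bool.T (isClique E (transfer C x))
    transfer-not-clique C x clique =
      no-clique-contains-UV {lookup (transfer C x)} (isClique-sound E (transfer C x) clique)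
        (λ i → ∈-transfer⁺ C x ∘ inj₂ ∘ inj₁)

    transfer-reflects-⊆ : ∀ {C D} w x → Lost C → Lost D → w ∈ UV → w ∈ lookup C → w ∈ lookup D →
                          x ∈ lookup T → transfer C x ≡ transfer D x → lookup C ⊆ lookup D
    transfer-reflects-⊆ {C} {D} w x lostC lostD w∈UV w∈C w∈D x∈T eq i i∈C = by-TS (T? (TS i))
      where
        from-transfer : i ∈ S → i ≢ w → Core D i ⊎ i ≡ x → i ∈ lookup D
        from-transfer _   _   (inj₁ (_ , inj₁ i∈D))  = i∈D
        from-transfer _   i≢w (inj₁ (_ , inj₂ i∈UV)) = ⊥-elim (UV-independent w∈UV i∈UV (i≢w ∘ sym)
          (isClique-sound E C (Lost.clique lostC) {w} {i} w∈C i∈C (i≢w ∘ sym)))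
        from-transfer i∈S _   (inj₂ i≡x)             = ⊥-elim (T∉S (subst (_∈ lookup T) (sym i≡x) x∈T) i∈S)
        in-S : i ∈ S → Dec (i ≡ w) → i ∈ lookup D
        in-S _   (yes i≡w) = subst (_∈ lookup D) (sym i≡w) w∈D
        in-S i∈S (no  i≢w) = from-transfer i∈S i≢w
          (∈-transfer⁻ D x (subst (λ X → i ∈ lookup X) eq (∈-transfer⁺ C x (inj₁ (i∈C , i∈S)))))
        by-TS : Dec (i ∈ TS) → i ∈ lookup D
        by-TS (no  i∉TS) = lost-outside-agree lostC lostD w∈UV w∈C w∈D i i∉TS i∈C
        by-TS (yes i∈TS) = [ (λ i∈T → ⊥-elim (lost-avoids-T lostC i∈C i∈T))
                           , (λ i∈S → in-S i∈S (i ≟ w))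
                           ]′ (∈-∪⁻ (lookup T) S i∈TS)

    transfer-injective : ∀ {C D} w x → Lost C → Lost D → w ∈ UV → w ∈ lookup C → w ∈ lookup D →
                         x ∈ lookup T → transfer C x ≡ transfer D x → C ≡ D
    transfer-injective w x lostC lostD w∈UV w∈C w∈D x∈T eq =
      ⊆-antisym (transfer-reflects-⊆ w x lostC lostD w∈UV w∈C w∈D x∈T eq)
                (transfer-reflects-⊆ w x lostD lostC w∈UV w∈D w∈C x∈T (sym eq))

    module Reassignment {x₁ x₂ : Fin n} (x₁≢x₂ : x₁ ≢ x₂)
                        (x₁∈T : x₁ ∈ lookup T) (x₂∈T : x₂ ∈ lookup T) where

      tag : Subset n → Fin n
      tag C = if lookup C u then x₁ else x₂

      tag∈T : ∀ C → tag C ∈ lookup T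
      tag∈T C with lookup C u
      ... | true  = x₁∈T
      ... | false = x₂∈T

      tag-determines-u : ∀ C D → tag C ≡ tag D → lookup C u ≡ lookup D u
      tag-determines-u C D eq with lookup C u | lookup D u
      ... | true  | true  = refl
      ... | true  | false = ⊥-elim (x₁≢x₂ eq)
      ... | false | true  = ⊥-elim (x₁≢x₂ (sym eq))
      ... | false | false = refl

      common-UV-vertex : ∀ {C D} → Lost C → Lost D → lookup C u ≡ lookup D u →
                         ∃ λ w → w ∈ UV × w ∈ lookup C × w ∈ lookup D
      common-UV-vertex {C} {D} lostC lostD eq = by-u (lookup C u) refl
        where
          by-u : ∀ b → lookup C u ≡ b → ∃ λ w → w ∈ UV × w ∈ lookup C × w ∈ lookup D
          by-u true  eqC = u , u∈UV , Equivalence.from T-≡ eqC , Equivalence.from T-≡ (trans (sym eq) eqC)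
          by-u false eqC = v , v∈UV , lost-meets-UV lostC (subst Bool.T eqC)
                                    , lost-meets-UV lostD (subst Bool.T (trans (sym eq) eqC))

      reassign : Subset n → Subset n
      reassign C = if isClique E′ C then C else transfer C (tag C)

      Reassigned : Subset n → Set
      Reassigned C = (Bool.T (isClique E′ C) × reassign C ≡ C) ⊎
                     (¬ Bool.T (isClique E′ C) × reassign C ≡ transfer C (tag C))

      reassign-cases : ∀ C → Reassigned C
      reassign-cases C = by-clique′ (isClique E′ C)
        where
          by-clique′ : ∀ b → (Bool.T b × (if b then C else transfer C (tag C)) ≡ C) ⊎
                             (¬ Bool.T b × (if b then C else transfer C (tag C)) ≡ transfer C (tag C))
          by-clique′ true  = inj₁ (_ , refl)
          by-clique′ false = inj₂ ((λ ()) , refl)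

      reassign-clique : ∀ {C} → Bool.T (isClique E C) → Bool.T (isClique E′ (reassign C))
      reassign-clique {C} cl = by-cases (reassign-cases C)
        where
          by-cases : Reassigned C → Bool.T (isClique E′ (reassign C))
          by-cases (inj₁ (cl′ , eq)) = subst (Bool.T ∘ isClique E′) (sym eq) cl′
          by-cases (inj₂ (_ , eq))   = subst (Bool.T ∘ isClique E′) (sym eq)
                                             (transfer-clique C (tag C) (isClique-sound E C cl) (tag∈T C))

      transfers-injective : ∀ {C D} → Lost C → Lost D → transfer C (tag C) ≡ transfer D (tag D) → C ≡ D
      transfers-injective {C} {D} lostC lostD transfers =
        let w , w∈UV , w∈C , w∈D = common-UV-vertex lostC lostD (tag-determines-u C D same-tag)
        in transfer-injective w (tag C) lostC lostD w∈UV w∈C w∈D (tag∈T C)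
             (trans transfers (cong (transfer D) (sym same-tag)))
        where
          same-tag : tag C ≡ tag D
          same-tag = transfer-meets-T D (tag D) (tag∈T C)
                       (subst (λ X → tag C ∈ lookup X) transfers (∈-transfer⁺ C (tag C) (inj₂ (inj₂ refl))))

      reassign-injective : ∀ {C D} → Bool.T (isClique E C) → Bool.T (isClique E D) →
                           reassign C ≡ reassign D → C ≡ D
      reassign-injective {C} {D} clC clD eq = by-cases (reassign-cases C) (reassign-cases D)
        where
          by-cases : Reassigned C → Reassigned D → C ≡ D
          by-cases (inj₁ (_ , eqC)) (inj₁ (_ , eqD)) = trans (sym eqC) (trans eq eqD)
          by-cases (inj₁ (_ , eqC)) (inj₂ (_ , eqD)) =
            ⊥-elim (transfer-not-clique D (tag D)
                     (subst (Bool.T ∘ isClique E) (trans (sym eqC) (trans eq eqD)) clC))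
          by-cases (inj₂ (_ , eqC)) (inj₁ (_ , eqD)) =
            ⊥-elim (transfer-not-clique C (tag C)
                     (subst (Bool.T ∘ isClique E) (trans (sym eqD) (trans (sym eq) eqC)) clD))
          by-cases (inj₂ (¬clC′ , eqC)) (inj₂ (¬clD′ , eqD)) =
            transfers-injective (lost clC ¬clC′) (lost clD ¬clD′) (trans (sym eqC) (trans eq eqD))

      UV-clique : Bool.T (isClique E′ (tabulate UV))
      UV-clique = isClique-complete E′ (tabulate UV) λ {i} {j} i∈ j∈ i≢j →
        rewire-U-edge UV TS E (in-UV i∈) (in-UV j∈) i≢j
        where
          in-UV : ∀ {i} → i ∈ lookup (tabulate UV) → i ∈ UV
          in-UV {i} = subst Bool.T (lookup∘tabulate UV i)

      reassign-misses-UV : ∀ {C} → Bool.T (isClique E C) → reassign C ≢ tabulate UV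
      reassign-misses-UV {C} cl eq = by-cases (reassign-cases C)
        where
          by-cases : Reassigned C → ⊥
          by-cases (inj₁ (_ , eqC)) = no-clique-contains-UV (isClique-sound E C cl) λ i i∈UV →
            subst (λ X → i ∈ lookup X) (trans (sym eq) eqC) (subst Bool.T (sym (lookup∘tabulate UV i)) i∈UV)
          by-cases (inj₂ (_ , eqC)) =
            T∉S (tag∈T C) (UV⊆S (tag C) (subst Bool.T (lookup∘tabulate UV (tag C))
              (subst (λ X → tag C ∈ lookup X) (trans (sym eqC) eq) (∈-transfer⁺ C (tag C) (inj₂ (inj₂ refl))))))

lemma4p7 : (n r : ℕ) (E : Adj n) → Symmetric E → Irreflexive E →
    MaxDeg≤ E r → (T : Subset n) → Tight E r T → 2 ≤ ∣ T ∣ →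
    (u v : Fin n) → K2ComponentOfR E T u v →
    MaxDeg≤ (modify E T u v) r × (k E < k (modify E T u v))
lemma4p7 n r E symE irrE Δ≤r T tight 2≤∣T∣ u v K2 with two-members T 2≤∣T∣
... | x₁ , x₂ , x₁≢x₂ , x₁∈T , x₂∈T = rewired-Δ≤r , more-cliques
  where
    open TightClique E symE irrE Δ≤r T tight
    open Rewiring u v K2
    open Reassignment x₁≢x₂ x₁∈T x₂∈T
    more-cliques : k E < k E′
    more-cliques = filterᵇ-length-<-by-injection (allSubsets-unique n) (allSubsets-complete n)
      (isClique E) (isClique E′) reassign reassign-clique reassign-injective
      (tabulate UV) UV-clique reassign-misses-UV
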